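{- For all positive integers $n$ and $k$, the path $P_n$ on $n$ vertices is a $k$-geometric mean graph.
   Context: Let $k$ be a positive integer. A finite simple graph $G$ with $p$ vertices and $q$ edges is a $k$-geometric mean graph if there is an injection $\psi: V(G)\to\{k,k+1,\dots,k+q\}$ such that, when each edge $uv$ is assigned one of the labels $\lfloor\sqrt{\psi(u)\psi(v)}\rfloor$ or $\lceil\sqrt{\psi(u)\psi(v)}\rceil$ (chosen per edge), the resulting set of edge labels is exactly $\{k,k+1,\dots,k+q-1\}$. -}

module Defs where

open import Data.Nat using (ℕ; zero; suc; _+_; _*_; _≤_; _<_)
open import Data.Fin using (Fin; inject₁) renaming (suc to fsuc)
open import Data.Product using (Σ; _×_; _,_; proj₁; proj₂; ∃-syntax)
open import Data.Sum using (_⊎_)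
open import Relation.Binary.PropositionalEquality using (_≡_)
open import Function.Definitions using (Injective)

record Graph : Set where
  field
    p    : ℕ
    q    : ℕ
    ends : Fin q → Fin p × Fin p

FloorSqrt : ℕ → ℕ → Set
FloorSqrt m s = (s * s ≤ m) × (∀ t → t * t ≤ m → t ≤ s)

CeilSqrt : ℕ → ℕ → Set
CeilSqrt m s = (m ≤ s * s) × (∀ t → m ≤ t * t → s ≤ t)

IsKGeometricMean : ℕ → Graph → Set
IsKGeometricMean k G =
  Σ (Fin p → ℕ) λ ψ →
    Injective _≡_ _≡_ ψ
    × (∀ v → k ≤ ψ v × ψ v ≤ k + q)
    × Σ (Fin q → ℕ) λ ℓ →
        (∀ e → FloorSqrt (ψ (proj₁ (ends e)) * ψ (proj₂ (ends e))) (ℓ e)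
             ⊎ CeilSqrt  (ψ (proj₁ (ends e)) * ψ (proj₂ (ends e))) (ℓ e))
        × (∀ e → k ≤ ℓ e × ℓ e < k + q)
        × (∀ j → k ≤ j → j < k + q → ∃[ e ] ℓ e ≡ j)
  where open Graph G

Path : ℕ → Graph
Path zero    = record { p = zero ; q = zero ; ends = λ () }
Path (suc m) = record { p = suc m ; q = m ; ends = λ i → inject₁ i , fsuc i }

module Submission where

-- We label it by translation: vertex i gets k + i, and edge e_i
-- gets k + i.  The endpoint labels of e_i are the consecutive numbers
-- a = k + i and a + 1, and the only arithmetic fact needed is
--
--     ⌊√(a (a+1))⌋ = a,   since  a² ≤ a(a+1) < (a+1)².
--
-- So every edge receives its floor label.  The vertex labels are injective
-- and lie in {k, …, k+m}; the edge labels are exactly {k, …, k+m-1}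
-- because translation by k is a bijection from Fin m onto that interval.

open import Defs
open import Data.Nat using (ℕ; suc; _+_; _*_; _∸_; _≤_; _<_; s≤s⁻¹)
open import Data.Nat.Properties
open import Data.Fin using (Fin; toℕ; fromℕ<; inject₁) renaming (suc to fsuc)
open import Data.Fin.Properties using (toℕ-injective; toℕ<n; toℕ-inject₁; toℕ-fromℕ<)
open import Data.Product using (_×_; _,_; ∃-syntax)
open import Data.Sum using (_⊎_; inj₁)
open import Function.Definitions using (Injective)
open import Relation.Binary.PropositionalEquality
open import Relation.Nullary using (contraposition)

-- Squaring is monotone, hence it reflects strict order.
squares-reflect-< : ∀ s t → t * t < s * s → t < s
squares-reflect-< s t t²<s² =
  ≰⇒> (contraposition (λ s≤t → *-mono-≤ s≤t s≤t) (<⇒≱ t²<s²))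

floorSqrt-consecutive : ∀ a → FloorSqrt (a * suc a) a
floorSqrt-consecutive a = *-monoʳ-≤ a (n≤1+n a) , maximal
  where
  below-next-square : a * suc a < suc a * suc a
  below-next-square = *-monoˡ-< (suc a) (n<1+n a)

  maximal : ∀ t → t * t ≤ a * suc a → t ≤ a
  maximal t t²≤ = s≤s⁻¹ (squares-reflect-< (suc a) t (≤-<-trans t²≤ below-next-square))

shift : (k : ℕ) {n : ℕ} → Fin n → ℕ
shift k i = k + toℕ i

shift-injective : ∀ k {n} → Injective _≡_ _≡_ (shift k {n})
shift-injective k eq = toℕ-injective (+-cancelˡ-≡ k _ _ eq)

shift-bounds : ∀ k {n} (i : Fin n) → k ≤ shift k i × shift k i < k + n
shift-bounds k i = m≤m+n k (toℕ i) , +-monoʳ-< k (toℕ<n i)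

shift-onto : ∀ k n j → k ≤ j → j < k + n → ∃[ i ] shift k {n} i ≡ j
shift-onto k n j k≤j j<k+n = fromℕ< j∸k<n , (begin
    k + toℕ (fromℕ< j∸k<n)  ≡⟨ cong (k +_) (toℕ-fromℕ< j∸k<n) ⟩
    k + (j ∸ k)             ≡⟨ m+[n∸m]≡n k≤j ⟩
    j                       ∎)
  where
  open ≡-Reasoning
  j∸k<n : j ∸ k < n
  j∸k<n = +-cancelˡ-< k _ _ (subst (_< k + n) (sym (m+[n∸m]≡n k≤j)) j<k+n)

edge-product : ∀ k {m} (i : Fin m) →
               shift k (inject₁ i) * shift k (fsuc i) ≡ shift k i * suc (shift k i)
edge-product k i = cong₂ _*_ (cong (k +_) (toℕ-inject₁ i)) (+-suc k (toℕ i))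

mainTheorem4 : (n k : ℕ) → 1 ≤ n → 1 ≤ k → IsKGeometricMean k (Path n)
mainTheorem4 (suc m) k _ _ =
  shift k , shift-injective k , vertex-bounds ,
  shift k , edge-label , shift-bounds k , shift-onto k m
  where
  vertex-bounds : ∀ (v : Fin (suc m)) → k ≤ shift k v × shift k v ≤ k + m
  vertex-bounds v = m≤m+n k (toℕ v) , +-monoʳ-≤ k (s≤s⁻¹ (toℕ<n v))

  edge-label : ∀ (i : Fin m) →
    FloorSqrt (shift k (inject₁ i) * shift k (fsuc i)) (shift k i)
      ⊎ CeilSqrt (shift k (inject₁ i) * shift k (fsuc i)) (shift k i)
  edge-label i = inj₁ (subst (λ x → FloorSqrt x (shift k i))
                             (sym (edge-product k i)) (floorSqrt-consecutive (shift k i)))
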